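{- Let $\vec\alpha\,F$ be an $n$-ary BNF and $\sim$ a type-polymorphic family of relations on $\vec\alpha\,F$ which at every type is an equivalence relation and satisfies $x\sim y\Rightarrow\mathrm{map}_F\,\vec f\,x\sim\mathrm{map}_F\,\vec f\,y$ for all $\vec f$. Let $\vec\alpha\,Q$ be the quotient $\vec\alpha\,F/{\sim}$ with $\mathrm{map}_Q$ and $\mathrm{set}_{Q,i}$ as defined below. Then for every $x$ and every $i$, $$\mathrm{set}_{Q,i}\,[x]_\sim=\bigcap_{y\in[\mathrm{map}_F\,\vec{\mathfrak e}\,x]_\sim}\{a\mid\mathfrak e\,a\in\mathrm{set}_{F,i}\,y\}.$$
   Context: HOL setting (all types non-empty); vector notation $\vec x=x_1,\dots,x_n$ with synchronized indices. An $n$-ary BNF is a type constructor $\vec\alpha\,F$ with polymorphic mapper $\mathrm{map}_F::(\alpha_1\to\beta_1)\to\cdots\to(\alpha_n\to\beta_n)\to\vec\alpha\,F\to\vec\beta\,F$, setters $\mathrm{set}_{F,i}::\vec\alpha\,F\to\alpha_i\ \mathrm{set}$, infinite cardinal bound $\mathrm{bd}_F$, relator $\mathrm{rel}_F$, satisfying: $\mathrm{map}_F\,\vec{\mathrm{id}}=\mathrm{id}$; $\mathrm{map}_F\,\vec g\circ\mathrm{map}_F\,\vec f=\mathrm{map}_F\,\overrightarrow{(g\circ f)}$; $\mathrm{set}_{F,i}(\mathrm{map}_F\,\vec f\,x)=f_i\langle\mathrm{set}_{F,i}\,x\rangle$ (image); if $f_i z=g_i z$ for all $i$ and $z\in\mathrm{set}_{F,i}\,x$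 then $\mathrm{map}_F\,\vec f\,x=\mathrm{map}_F\,\vec g\,x$; $|\mathrm{set}_{F,i}\,x|\le\mathrm{bd}_F$; $(x,y)\in\mathrm{rel}_F\,\vec R$ iff some $z$ has $\mathrm{set}_{F,i}\,z\subseteq R_i$ for all $i$, $\mathrm{map}_F\,\overrightarrow{\mathrm{fst}}\,z=x$, $\mathrm{map}_F\,\overrightarrow{\mathrm{snd}}\,z=y$; $\mathrm{rel}_F\,\vec R\bullet\mathrm{rel}_F\,\vec S\subseteq\mathrm{rel}_F\,\overrightarrow{(R\bullet S)}$. Notation: $[x]_\sim=\{y\mid x\sim y\}$; $\mathsf 1+\alpha$ is the sum of the unit type and $\alpha$, with $\circledast$ the left injection of the unit element and $\mathfrak e::\alpha\to\mathsf 1+\alpha$ the right injection. The quotient $\vec\alpha\,Q$ consists of the $\sim$-equivalence classes $[x]_\sim$, with mapper $\mathrm{map}_Q\,\vec f\,[x]_\sim=[\mathrm{map}_F\,\vec f\,x]_\sim$. Define $Q_{\mathrm{in}}\,\vec A=\{q\mid\forall\vec f\,\vec g.\ (\forall i.\ \forall a\in A_i.\ f_i\,a=g_i\,a)\longrightarrow\mathrm{map}_Q\,\vec f\,q=\mathrm{map}_Q\,\vec g\,q\}$ with $f_i,g_i::\alpha_i\to\mathsf 1+\alpha_i$, and $\mathrm{set}_{Q,i}\,q=\bigcap\{A_i\mid q\in Q_{\mathrm{in}}\,\mathrm{UNIV}\cdots\mathrm{UNIV}\,A_i\,\mathrm{UNIV}\cdots\mathrm{UNIV}\}$, where $A_i$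 is in the $i$-th argument position and $\mathrm{UNIV}$ (the set of all elements of the respective type) in all others. -}

module Defs where

open import Level using (0ℓ)
open import Data.Nat using (ℕ)
open import Data.Fin using (Fin; _≟_)
open import Data.Unit using (⊤; tt)
open import Data.Sum using (_⊎_; inj₁; inj₂)
open import Data.Product using (Σ; ∃; _×_; _,_; proj₁; proj₂)
open import Relation.Nullary using (yes; no)
open import Relation.Binary.PropositionalEquality using (_≡_; refl)
open import Relation.Binary.Structures using (IsEquivalence)

TyVec : ℕ → Set₁
TyVec n = Fin n → Set

FunVec : ∀ {n} → TyVec n → TyVec n → Set
FunVec {n} α β = (i : Fin n) → α i → β i

RelVec : ∀ {n} → TyVec n → TyVec n → Set₁
RelVec {n} α β = (i : Fin n) → α i → β i → Set

PairVec : ∀ {n} → TyVec n → TyVec n → TyVec n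
PairVec α β i = α i × β i

_•_ : ∀ {n} {α β γ : TyVec n} → RelVec α β → RelVec β γ → RelVec α γ
(R • S) i a c = Σ _ λ b → R i a b × S i b c

OnePlus : ∀ {n} → TyVec n → TyVec n
OnePlus α i = ⊤ ⊎ α i

⊛ : {A : Set} → ⊤ ⊎ A
⊛ = inj₁ tt

𝔢 : {A : Set} → A → ⊤ ⊎ A
𝔢 = inj₂

-- "Σ (set) injects into bd", i.e. |S| ≤ |bd| for a predicate-set S
record CardLeq {A : Set} (S : A → Set) (bd : Set) : Set where
  field
    ι   : (a : A) → S a → bd
    inj : ∀ a b (p : S a) (q : S b) → ι a p ≡ ι b q → a ≡ b

record Infinite (bd : Set) : Set where
  field
    ι   : ℕ → bd
    inj : ∀ m k → ι m ≡ ι k → m ≡ k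

-- An n-ary bounded natural functor (sets are predicates, set equalities are
-- pointwise iff, function equalities are pointwise).
record BNF (n : ℕ) : Set₁ where
  field
    F     : TyVec n → Set
    map   : ∀ {α β : TyVec n} → FunVec α β → F α → F β
    set   : ∀ {α : TyVec n} (i : Fin n) → F α → α i → Set
    bd    : Set
    rel   : ∀ {α β : TyVec n} → RelVec α β → F α → F β → Set
    map-id   : ∀ {α : TyVec n} (x : F α) → map (λ i a → a) x ≡ x
    map-comp : ∀ {α β γ : TyVec n} (f : FunVec α β) (g : FunVec β γ) (x : F α) →
               map g (map f x) ≡ map (λ i a → g i (f i a)) x
    set-map-⇒ : ∀ {α β : TyVec n} (f : FunVec α β) (x : F α) (i : Fin n) (b : β i) →
               set i (map f x) b → Σ (α i) λ a → set i x a × f i a ≡ b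
    set-map-⇐ : ∀ {α β : TyVec n} (f : FunVec α β) (x : F α) (i : Fin n) (b : β i) →
               Σ (α i) (λ a → set i x a × f i a ≡ b) → set i (map f x) b
    map-cong : ∀ {α β : TyVec n} (f g : FunVec α β) (x : F α) →
               (∀ i (z : α i) → set i x z → f i z ≡ g i z) → map f x ≡ map g x
    bd-infinite : Infinite bd
    set-bd   : ∀ {α : TyVec n} (x : F α) (i : Fin n) → CardLeq (set i x) bd
    rel-⇒ : ∀ {α β : TyVec n} (R : RelVec α β) (x : F α) (y : F β) →
            rel R x y →
            Σ (F (PairVec α β)) λ z →
              (∀ i (p : α i × β i) → set i z p → R i (proj₁ p) (proj₂ p)) ×
              map (λ i → proj₁) z ≡ x × map (λ i → proj₂) z ≡ y
    rel-⇐ : ∀ {α β : TyVec n} (R : RelVec α β) (x : F α) (y : F β) →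
            (Σ (F (PairVec α β)) λ z →
              (∀ i (p : α i × β i) → set i z p → R i (proj₁ p) (proj₂ p)) ×
              map (λ i → proj₁) z ≡ x × map (λ i → proj₂) z ≡ y) →
            rel R x y
    rel-comp : ∀ {α β γ : TyVec n} (R : RelVec α β) (S : RelVec β γ)
               (x : F α) (y : F β) (w : F γ) →
               rel R x y → rel S y w → rel (R • S) x w

module Quot {n : ℕ} (B : BNF n)
            (_∼_ : ∀ {α : TyVec n} → BNF.F B α → BNF.F B α → Set) where
  open BNF B

  atPos : ∀ {α : TyVec n} (i : Fin n) → (α i → Set) → (j : Fin n) → α j → Set
  atPos i A j with j ≟ i
  ... | yes refl = A
  ... | no _ = λ _ → ⊤

  -- q ∈ Q_in A  for q = [x]_∼, with map_Q f [x] = [map_F f x] and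
  -- equality of classes given by ∼
  Qin : ∀ {α : TyVec n} → ((i : Fin n) → α i → Set) → F α → Set
  Qin {α} A x = (f g : FunVec α (OnePlus α)) →
                (∀ i (a : α i) → A i a → f i a ≡ g i a) →
                map f x ∼ map g x

  -- set_{Q,i} [x]_∼ = ⋂ { A_i | [x] ∈ Q_in UNIV .. A_i .. UNIV }
  setQ : ∀ {α : TyVec n} (i : Fin n) → F α → α i → Set₁
  setQ {α} i x a = (A : α i → Set) → Qin (atPos i A) x → A a

{-# OPTIONS --safe #-}
module Submission where

-- Both sides describe the least A through which the class of x is determined.
-- (⇒) For y ∼ map 𝔢 x, the set A = {a | 𝔢 a ∈ set_i y} determines [x]: maps
-- f, g agreeing on A extend (fixing ⊛) to maps agreeing on set_i y, and
-- map f x = map f⁺ (map 𝔢 x) ∼ map f⁺ y = map g⁺ y ∼ map g x.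
-- (⇐) Given A determining [x], send the elements of α_i outside A to ⊛
-- (a classical case split); the result is ∼-related to map 𝔢 x, and 𝔢 a can
-- occur in its i-th set only if a ∈ A.

open import Defs
open import Level using (0ℓ; suc)
open import Data.Fin using (Fin; _≟_)
open import Data.Unit using (tt)
open import Data.Sum using (inj₁; inj₂; [_,_]′)
open import Data.Product using (_,_)
open import Data.Empty using (⊥-elim)
open import Axiom.ExcludedMiddle using (ExcludedMiddle)
open import Axiom.Extensionality.Propositional using (Extensionality)
open import Function.Bundles using (_⇔_; mk⇔)
open import Relation.Nullary using (yes; no)
open import Relation.Binary.Bundles using (Setoid)
open import Relation.Binary.Structures using (IsEquivalence)
open import Relation.Binary.PropositionalEquality using (_≡_; refl)
import Relation.Binary.Reasoning.Setoid as SetoidReasoning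

extendOnePlus : ∀ {n} {α β : TyVec n} → FunVec α (OnePlus β) → FunVec (OnePlus α) (OnePlus β)
extendOnePlus f j = [ inj₁ , f j ]′

collapseOutside : ExcludedMiddle 0ℓ → ∀ {n} {α : TyVec n} (i : Fin n) → (α i → Set) →
                  FunVec α (OnePlus α)
collapseOutside em i A j b with j ≟ i
... | no _ = 𝔢 b
... | yes refl with em {A b}
...   | yes _ = 𝔢 b
...   | no _ = ⊛

collapseOutside-𝔢⇒∈ : (em : ExcludedMiddle 0ℓ) → ∀ {n} {α : TyVec n} (i : Fin n)
                      (A : α i → Set) (a b : α i) →
                      collapseOutside em {α = α} i A i b ≡ 𝔢 a → A a
collapseOutside-𝔢⇒∈ em i A a b eq with i ≟ i
... | no i≢i = ⊥-elim (i≢i refl)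
... | yes refl with em {A b} | eq
...   | yes b∈A | refl = b∈A

module _ {n} (B : BNF n) (_∼_ : ∀ {α : TyVec n} → BNF.F B α → BNF.F B α → Set) where
  open BNF B
  open Quot B _∼_

  ⊆-atPos : ∀ {α : TyVec n} (P : (j : Fin n) → α j → Set) (i : Fin n) →
            ∀ j b → P j b → atPos i (P i) j b
  ⊆-atPos P i j b p with j ≟ i
  ... | yes refl = p
  ... | no _ = tt

  collapseOutside-agrees : (em : ExcludedMiddle 0ℓ) → ∀ {α : TyVec n} (i : Fin n)
                           (A : α i → Set) →
                           ∀ j (b : α j) → atPos i A j b → 𝔢 b ≡ collapseOutside em {α = α} i A j b
  collapseOutside-agrees em i A j b b∈A with j ≟ i
  ... | no _ = refl
  ... | yes refl with em {A b}
  ...   | yes _ = refl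
  ...   | no b∉A = ⊥-elim (b∉A b∈A)

  Qin-mono : ∀ {α : TyVec n} {A A′ : (j : Fin n) → α j → Set} {x : F α} →
             (∀ j b → A j b → A′ j b) → Qin A x → Qin A′ x
  Qin-mono A⊆A′ qin f g agree = qin f g (λ j b b∈A → agree j b (A⊆A′ j b b∈A))

  set-𝔢⇒setQ : ExcludedMiddle 0ℓ → ∀ {α : TyVec n} (x : F α) (i : Fin n) (a : α i) →
                (∀ (y : F (OnePlus α)) → map (λ j → 𝔢) x ∼ y → set i y (𝔢 a)) →
                setQ i x a
  set-𝔢⇒setQ em x i a 𝔢a∈related A x∈QinA
    with set-map-⇒ (collapseOutside em i A) x i (𝔢 a)
           (𝔢a∈related _ (x∈QinA _ _ (collapseOutside-agrees em i A)))
  ... | b , _ , eq = collapseOutside-𝔢⇒∈ em i A a b eq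

  module _ (∼-isEquivalence : ∀ {α : TyVec n} → IsEquivalence (_∼_ {α}))
           (map-resp-∼ : ∀ {α β : TyVec n} (f : FunVec α β) (x y : F α) →
                         x ∼ y → map f x ∼ map f y) where

    ∼-setoid : TyVec n → Setoid 0ℓ 0ℓ
    ∼-setoid α = record { Carrier = F α ; _≈_ = _∼_ ; isEquivalence = ∼-isEquivalence }

    Qin-related : ∀ {α : TyVec n} (x : F α) (y : F (OnePlus α)) →
                  map (λ j → 𝔢) x ∼ y → Qin (λ j b → set j y (𝔢 b)) x
    Qin-related {α} x y 𝔢x∼y f g agree = begin
      map f x                             ≡⟨ map-comp (λ j → 𝔢) (extendOnePlus f) x ⟨
      map (extendOnePlus f) (map 𝔢s x)   ≈⟨ map-resp-∼ (extendOnePlus f) _ _ 𝔢x∼y ⟩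
      map (extendOnePlus f) y             ≡⟨ map-cong _ _ y extensions-agree ⟩
      map (extendOnePlus g) y             ≈⟨ map-resp-∼ (extendOnePlus g) _ _ 𝔢x∼y ⟨
      map (extendOnePlus g) (map 𝔢s x)   ≡⟨ map-comp (λ j → 𝔢) (extendOnePlus g) x ⟩
      map g x                             ∎
      where
      open SetoidReasoning (∼-setoid (OnePlus α))
      𝔢s : FunVec α (OnePlus α)
      𝔢s j = 𝔢
      extensions-agree : ∀ j (z : OnePlus α j) → set j y z → extendOnePlus f j z ≡ extendOnePlus g j z
      extensions-agree j (inj₁ _) _ = refl
      extensions-agree j (inj₂ b) 𝔢b∈y = agree j b 𝔢b∈y

    setQ⇒set-𝔢 : ∀ {α : TyVec n} (x : F α) (i : Fin n) (a : α i) → setQ i x a →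
                 ∀ (y : F (OnePlus α)) → map (λ j → 𝔢) x ∼ y → set i y (𝔢 a)
    setQ⇒set-𝔢 x i a a∈setQ y 𝔢x∼y =
      a∈setQ (λ b → set i y (𝔢 b))
             (Qin-mono (⊆-atPos (λ j b → set j y (𝔢 b)) i) (Qin-related x y 𝔢x∼y))

theorem3p6 : ExcludedMiddle 0ℓ → ExcludedMiddle (suc 0ℓ) → Extensionality 0ℓ 0ℓ →
    ∀ {n} (B : BNF n) (_∼_ : ∀ {α : TyVec n} → BNF.F B α → BNF.F B α → Set) →
    (∀ {α : TyVec n} → IsEquivalence (_∼_ {α})) →
    (∀ {α β : TyVec n} (f : FunVec α β) (x y : BNF.F B α) →
      x ∼ y → BNF.map B f x ∼ BNF.map B f y) →
    ∀ {α : TyVec n} (x : BNF.F B α) (i : Fin n) (a : α i) →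
      Quot.setQ B _∼_ i x a
        ⇔ (∀ (y : BNF.F B (OnePlus α)) → BNF.map B (λ j → 𝔢) x ∼ y → BNF.set B i y (𝔢 a))
theorem3p6 em _ _ B _∼_ ∼-isEquivalence map-resp-∼ x i a =
  mk⇔ (setQ⇒set-𝔢 B _∼_ ∼-isEquivalence map-resp-∼ x i a) (set-𝔢⇒setQ B _∼_ em x i a)
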